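{- Let $\Gamma=(P,L,I)$ be a rank $2$ incidence geometry and let $\lambda,k_1,k_2,l\in\mathbb{N}$ satisfy $k_1+k_2-\lambda\geq l$. Consider a configuration of the pebble game on $\Gamma$ (reached by legal moves from the initial configuration), with set of accepted edges $D$, and let $I_D\subseteq I$ be the set of incidences having at least one associated edge in $D$. Suppose $i_0\in I_D$ is such that for every $i\in I_D$ with $i\neq i_0$ all $\lambda$ edges associated to $i$ are in $D$, while some edge associated to $i_0$ is not in $D$. If the incidence geometry $(P,L,I_D)$ is $(\lambda,k_1,k_2,l)$-sparse, then by a finite sequence of legal moves ($\textbf{Move-Pebble}$ and $\textbf{Accept-Edge}$) all edges associated to $i_0$ can be accepted.
   Context: A rank $2$ incidence geometry is a triple $\Gamma=(P,L,I)$ with $P$ (points) and $L$ (lines) finite disjoint sets and $I\subseteq P\times L$. For $I'\subseteq I$, its support is $P(I')\times L(I')$ where $P(I')=\{p:\exists \ell,\ (p,\ell)\in I'\}$ and $L(I')=\{\ell:\exists p,\ (p,\ell)\in I'\}$. $(P,L,J)$ is $(\lambda,k_1,k_2,l)$-sparse if for every nonempty $J'\subseteq J$, $\lambda|J'|\leq k_1|P(J')|+k_2|L(J')|-l$. Pebble game. Let $I_\lambda(\Gamma)$ be the multigraph with vertex set $P\cup L$ and edge set $\{(p,\ell,i): (p,\ell)\in I,\ i\in\{1,\dots,\lambda\}\}$, the edge $(p,\ell,i)$ having endpoints $p,\ell$ and being associated to the incidence $(p,\ell)$. Set $\tau(v)=1$ for $v\in P$, $\tau(v)=2$ for $v\in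 L$. The game maintains a directed multigraph $D$ on $P\cup L$ whose edges (accepted edges) are a subset of the edges of $I_\lambda(\Gamma)$, each oriented, and a pebble count $\mathrm{peb}(v)\in\mathbb{N}$ at each vertex. Initially $D$ is empty and $\mathrm{peb}(v)=k_{\tau(v)}$. Legal moves: - $\textbf{Accept-Edge}(e)$: if $e=(v,w,i)$ is not in $D$ and $\mathrm{peb}(v)+\mathrm{peb}(w)>l$, remove a pebble from an endpoint $x\in\{v,w\}$ with $\mathrm{peb}(x)>0$ and add $e$ to $D$ oriented from $x$ to the other endpoint. - $\textbf{Move-Pebble}(v\leftarrow w)$: if there is a directed path in $D$ from $v$ to $w$ and $\mathrm{peb}(w)>0$, add a pebble to $v$, remove one from $w$, and reverse every edge of the path. -}

module Defs where

open import Data.Nat using (ℕ; zero; suc; _+_; _*_; _∸_; _≤_; _<_)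
open import Data.Fin using (Fin; zero; suc)
open import Data.Bool using (Bool; true; false; _∨_; _∧_; if_then_else_)
open import Data.Maybe using (Maybe; just; nothing; is-just)
open import Data.Sum using (_⊎_; inj₁; inj₂)
open import Data.Product using (Σ; _×_; _,_)
open import Data.List using (List; []; _∷_)
open import Data.List.Relation.Unary.Unique.Propositional using (Unique)
open import Relation.Binary.PropositionalEquality using (_≡_)
open import Relation.Nullary.Decidable using (⌊_⌋)
open import Relation.Binary.Construct.Closure.ReflexiveTransitive using (Star)
import Data.Fin as F

sumFin : ∀ {n} → (Fin n → ℕ) → ℕ
sumFin {zero}  f = 0
sumFin {suc n} f = f zero + sumFin (λ x → f (suc x))

count : ∀ {n} → (Fin n → Bool) → ℕ
count f = sumFin (λ x → if f x then 1 else 0)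

anyFin : ∀ {n} → (Fin n → Bool) → Bool
anyFin {zero}  f = false
anyFin {suc n} f = f zero ∨ anyFin (λ x → f (suc x))

Incidences : ℕ → ℕ → Set
Incidences np nl = Fin np → Fin nl → Bool

_⊆I_ : ∀ {np nl} → Incidences np nl → Incidences np nl → Set
J' ⊆I J = ∀ p ℓ → J' p ℓ ≡ true → J p ℓ ≡ true

size : ∀ {np nl} → Incidences np nl → ℕ
size J = sumFin (λ p → count (J p))

numPoints : ∀ {np nl} → Incidences np nl → ℕ
numPoints J = count (λ p → anyFin (J p))

numLines : ∀ {np nl} → Incidences np nl → ℕ
numLines J = count (λ ℓ → anyFin (λ p → J p ℓ))

-- (P,L,J) is (λ,k₁,k₂,l)-sparse: for every nonempty J' ⊆ J,
-- λ|J'| ≤ k₁|P(J')| + k₂|L(J')| − l   (integer subtraction; written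
-- equivalently in ℕ by moving l to the left).
Sparse : ∀ {np nl} → (lam k₁ k₂ l : ℕ) → Incidences np nl → Set
Sparse lam k₁ k₂ l J =
  ∀ J' → J' ⊆I J → 0 < size J' →
  lam * size J' + l ≤ k₁ * numPoints J' + k₂ * numLines J'

Vertex : ℕ → ℕ → Set
Vertex np nl = Fin np ⊎ Fin nl

kτ : ∀ {np nl} → ℕ → ℕ → Vertex np nl → ℕ
kτ k₁ k₂ (inj₁ _) = k₁
kτ k₁ k₂ (inj₂ _) = k₂

_=V_ : ∀ {np nl} → Vertex np nl → Vertex np nl → Bool
inj₁ p =V inj₁ q = ⌊ p F.≟ q ⌋
inj₂ a =V inj₂ b = ⌊ a F.≟ b ⌋
_      =V _      = false

data Dir : Set where
  P→L L→P : Dir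

flipDir : Dir → Dir
flipDir P→L = L→P
flipDir L→P = P→L

Edge : ℕ → ℕ → ℕ → Set
Edge np nl lam = Fin np × Fin nl × Fin lam

_=E_ : ∀ {np nl lam} → Edge np nl lam → Edge np nl lam → Bool
(p , ℓ , i) =E (q , m , j) = ⌊ p F.≟ q ⌋ ∧ ⌊ ℓ F.≟ m ⌋ ∧ ⌊ i F.≟ j ⌋

elemE : ∀ {np nl lam} → Edge np nl lam → List (Edge np nl lam) → Bool
elemE e []       = false
elemE e (f ∷ fs) = (e =E f) ∨ elemE e fs

-- A configuration: the directed multigraph D (for each edge of I_λ,
-- nothing = not in D, just d = in D with orientation d) and pebble counts.
record Config (np nl lam : ℕ) : Set where
  constructor config
  field
    acc : Fin np → Fin nl → Fin lam → Maybe Dir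
    peb : Vertex np nl → ℕ
open Config public

initial : ∀ {np nl lam} → (k₁ k₂ : ℕ) → Config np nl lam
initial k₁ k₂ = config (λ _ _ _ → nothing) (kτ k₁ k₂)

data Arc {np nl lam} (c : Config np nl lam) :
     Vertex np nl → Edge np nl lam → Vertex np nl → Set where
  pl : ∀ p ℓ i → acc c p ℓ i ≡ just P→L → Arc c (inj₁ p) (p , ℓ , i) (inj₂ ℓ)
  lp : ∀ p ℓ i → acc c p ℓ i ≡ just L→P → Arc c (inj₂ ℓ) (p , ℓ , i) (inj₁ p)

data Walk {np nl lam} (c : Config np nl lam) :
     Vertex np nl → Vertex np nl → Set where
  []  : ∀ {v} → Walk c v v
  _∷_ : ∀ {u e v w} → Arc c u e v → Walk c v w → Walk c u w

walkVertices : ∀ {np nl lam} {c : Config np nl lam} {v w} →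
               Walk c v w → List (Vertex np nl)
walkVertices {v = v} []       = v ∷ []
walkVertices {v = v} (_ ∷ ws) = v ∷ walkVertices ws

walkEdges : ∀ {np nl lam} {c : Config np nl lam} {v w} →
            Walk c v w → List (Edge np nl lam)
walkEdges []             = []
walkEdges (_∷_ {e = e} _ ws) = e ∷ walkEdges ws

record Path {np nl lam} (c : Config np nl lam) (v w : Vertex np nl) : Set where
  constructor path
  field
    walk   : Walk c v w
    simple : Unique (walkVertices walk)
open Path public

adjust : ∀ {np nl} → (Vertex np nl → ℕ) → Vertex np nl → (ℕ → ℕ) →
         Vertex np nl → ℕ
adjust f v g x = if x =V v then g (f x) else f x

setAcc : ∀ {np nl lam} → (Fin np → Fin nl → Fin lam → Maybe Dir) →
         Edge np nl lam → Maybe Dir → Fin np → Fin nl → Fin lam → Maybe Dir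
setAcc a e d p ℓ i = if (p , ℓ , i) =E e then d else a p ℓ i

reverseEdges : ∀ {np nl lam} → (Fin np → Fin nl → Fin lam → Maybe Dir) →
               List (Edge np nl lam) → Fin np → Fin nl → Fin lam → Maybe Dir
reverseEdges a es p ℓ i =
  if elemE (p , ℓ , i) es then Data.Maybe.map flipDir (a p ℓ i) else a p ℓ i
  where import Data.Maybe

data Move {np nl} (I : Incidences np nl) (lam k₁ k₂ l : ℕ) :
     Config np nl lam → Config np nl lam → Set where
  -- Accept-Edge((p,ℓ,i)), pebble taken from the point p, oriented p → ℓ
  accept-P : ∀ {c} p ℓ i → I p ℓ ≡ true → acc c p ℓ i ≡ nothing →
             l < peb c (inj₁ p) + peb c (inj₂ ℓ) → 0 < peb c (inj₁ p) →
             Move I lam k₁ k₂ l c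
               (config (setAcc (acc c) (p , ℓ , i) (just P→L))
                       (adjust (peb c) (inj₁ p) (λ n → n ∸ 1)))
  -- Accept-Edge((p,ℓ,i)), pebble taken from the line ℓ, oriented ℓ → p
  accept-L : ∀ {c} p ℓ i → I p ℓ ≡ true → acc c p ℓ i ≡ nothing →
             l < peb c (inj₁ p) + peb c (inj₂ ℓ) → 0 < peb c (inj₂ ℓ) →
             Move I lam k₁ k₂ l c
               (config (setAcc (acc c) (p , ℓ , i) (just L→P))
                       (adjust (peb c) (inj₂ ℓ) (λ n → n ∸ 1)))
  move-pebble : ∀ {c} v w → (π : Path c v w) → 0 < peb c w →
             Move I lam k₁ k₂ l c
               (config (reverseEdges (acc c) (walkEdges (walk π)))
                       (adjust (adjust (peb c) v suc) w (λ n → n ∸ 1)))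

Moves : ∀ {np nl} (I : Incidences np nl) (lam k₁ k₂ l : ℕ) →
        Config np nl lam → Config np nl lam → Set
Moves I lam k₁ k₂ l = Star (Move I lam k₁ k₂ l)

ID : ∀ {np nl lam} → Config np nl lam → Incidences np nl
ID c p ℓ = anyFin (λ i → is-just (acc c p ℓ i))

-- Every move of the pebble game preserves peb v + outdeg v = k_τ(v). Let R be the set of
-- vertices reachable in D from p₀ or ℓ₀. R is closed under arcs, so an arc leaving a vertex of R
-- is an edge of an incidence of I_D with both ends in R; if J' is the set of these incidences
-- there are at most λ|J'| − 1 such arcs, the −1 being the missing edge of (p₀, ℓ₀). Summing
-- the invariant over R and applying sparsity to J' leaves at least l + 1 pebbles on R. While
-- p₀ and ℓ₀ together hold at most l of them, some other vertex of R holds one, and Move-Pebble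
-- brings it to p₀ or ℓ₀ along a path. With l + 1 pebbles there an edge of (p₀, ℓ₀) can be
-- accepted; this leaves I_D unchanged, so the argument repeats for each of the λ edges.
module Submission where

open import Defs
open import Data.Nat using (ℕ; zero; suc; _+_; _*_; _∸_; _≤_; _<_; z≤n; s≤s; _≤?_; _<?_)
open import Data.Nat.Properties
open import Data.Nat.Tactic.RingSolver using (solve-∀)
open import Data.Fin using (Fin; zero; suc)
import Data.Fin.Properties as Fin
open import Data.Bool using (Bool; true; false; _∨_; _∧_; if_then_else_)
open import Data.Bool.Properties using (∨-zeroʳ)
open import Data.Maybe using (Maybe; just; nothing; is-just)
import Data.Maybe as Maybe
open import Data.Maybe.Properties using (just-injective)
open import Data.Product using (Σ; ∃; _×_; _,_; proj₁; proj₂)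
open import Data.Sum using (_⊎_; inj₁; inj₂)
import Data.Sum.Properties as Sum
open import Data.Empty using (⊥-elim)
open import Data.List using (List; []; _∷_; allFin)
open import Data.List.Relation.Unary.Any using (here; there)
import Data.List.Relation.Unary.All as All
open import Data.List.Relation.Unary.All.Properties.Core using (¬Any⇒All¬)
open import Data.List.Relation.Unary.AllPairs using (_∷_; [])
open import Data.List.Relation.Unary.Unique.Propositional using (Unique)
open import Data.List.Membership.Propositional using (_∈_)
open import Data.List.Membership.Propositional.Properties using (∈-allFin)
open import Relation.Binary.Construct.Closure.ReflexiveTransitive using (ε; _◅_; _◅◅_; fold)
open import Function using (_∘_; id)
open import Relation.Binary.PropositionalEquality
open import Relation.Nullary using (¬_; yes; no; ¬?; _×-dec_; contradiction)
import Algebra.Properties.CommutativeMonoid.Sum as MonoidSum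
import Algebra.Properties.Semiring.Sum as SemiringSum

open MonoidSum +-0-commutativeMonoid using (sum; sum-cong-≗; ∑-distrib-+; ∑-comm)
open SemiringSum +-*-semiring using (*-distribˡ-sum)

guard : Bool → ℕ → ℕ
guard b n = if b then n else 0

sumFin-cong : ∀ {n} {f g : Fin n → ℕ} → (∀ x → f x ≡ g x) → sumFin f ≡ sumFin g
sumFin-cong {zero}  h = refl
sumFin-cong {suc n} h = cong₂ _+_ (h zero) (sumFin-cong (h ∘ suc))

sumFin-mono-≤ : ∀ {n} {f g : Fin n → ℕ} → (∀ x → f x ≤ g x) → sumFin f ≤ sumFin g
sumFin-mono-≤ {zero}  h = z≤n
sumFin-mono-≤ {suc n} h = +-mono-≤ (h zero) (sumFin-mono-≤ (h ∘ suc))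

sumFin-mono-< : ∀ {n} {f g : Fin n → ℕ} → (∀ x → f x ≤ g x) →
                ∀ j → f j < g j → sumFin f < sumFin g
sumFin-mono-< h zero    lt = +-mono-<-≤ lt (sumFin-mono-≤ (h ∘ suc))
sumFin-mono-< h (suc j) lt = +-mono-≤-< (h zero) (sumFin-mono-< (h ∘ suc) j lt)

sumFin-const : ∀ n k → sumFin {n} (λ _ → k) ≡ n * k
sumFin-const zero    k = refl
sumFin-const (suc n) k = cong (k +_) (sumFin-const n k)

sumFin-zero : ∀ n → sumFin {n} (λ _ → 0) ≡ 0
sumFin-zero n = trans (sumFin-const n 0) (*-zeroʳ n)

sumFin-one : ∀ n → sumFin {n} (λ _ → 1) ≡ n
sumFin-one n = trans (sumFin-const n 1) (*-identityʳ n)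

sumFin≡sum : ∀ {n} (f : Fin n → ℕ) → sumFin f ≡ sum f
sumFin≡sum {zero}  f = refl
sumFin≡sum {suc n} f = cong (f zero +_) (sumFin≡sum (f ∘ suc))

sumFin₂≡sum₂ : ∀ {m n} (f : Fin m → Fin n → ℕ) →
               sumFin (λ x → sumFin (f x)) ≡ sum (λ x → sum (f x))
sumFin₂≡sum₂ f = trans (sumFin≡sum (λ x → sumFin (f x))) (sum-cong-≗ (sumFin≡sum ∘ f))

sumFin-distrib-+ : ∀ {n} (f g : Fin n → ℕ) →
                   sumFin (λ x → f x + g x) ≡ sumFin f + sumFin g
sumFin-distrib-+ f g = begin
  sumFin (λ x → f x + g x) ≡⟨ sumFin≡sum (λ x → f x + g x) ⟩
  sum (λ x → f x + g x)    ≡⟨ ∑-distrib-+ f g ⟩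
  sum f + sum g            ≡⟨ cong₂ _+_ (sumFin≡sum f) (sumFin≡sum g) ⟨
  sumFin f + sumFin g      ∎
  where open ≡-Reasoning

sumFin-comm : ∀ {m n} (f : Fin m → Fin n → ℕ) →
              sumFin (λ x → sumFin (f x)) ≡ sumFin (λ y → sumFin (λ x → f x y))
sumFin-comm f = begin
  sumFin (λ x → sumFin (f x))        ≡⟨ sumFin₂≡sum₂ f ⟩
  sum (λ x → sum (f x))              ≡⟨ ∑-comm f ⟩
  sum (λ y → sum (λ x → f x y))      ≡⟨ sumFin₂≡sum₂ (λ y x → f x y) ⟨
  sumFin (λ y → sumFin (λ x → f x y)) ∎
  where open ≡-Reasoning

*-distribˡ-sumFin : ∀ {n} k (f : Fin n → ℕ) → k * sumFin f ≡ sumFin (λ x → k * f x)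
*-distribˡ-sumFin k f = begin
  k * sumFin f            ≡⟨ cong (k *_) (sumFin≡sum f) ⟩
  k * sum f               ≡⟨ *-distribˡ-sum k f ⟩
  sum (λ x → k * f x)     ≡⟨ sumFin≡sum (λ x → k * f x) ⟨
  sumFin (λ x → k * f x)  ∎
  where open ≡-Reasoning

-- x ⊖ y ≈ u ⊖ v states x − y = u − v in ℤ without leaving ℕ.
infix 4 _⊖_≈_⊖_
record _⊖_≈_⊖_ (x y u v : ℕ) : Set where
  constructor mk⊖≈
  field
    cross : x + v ≡ u + y
open _⊖_≈_⊖_ using (cross)

⊖≈-telescope : ∀ {x y z u v w} → x ⊖ y ≈ u ⊖ v → y ⊖ z ≈ v ⊖ w → x ⊖ z ≈ u ⊖ w
⊖≈-telescope {x} {y} {z} {u} {v} {w} (mk⊖≈ h₁) (mk⊖≈ h₂) = mk⊖≈ (+-cancelʳ-≡ (v + y) _ _ (begin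
  x + w + (v + y)   ≡⟨ regroup x w v y ⟩
  (x + v) + (y + w) ≡⟨ cong₂ _+_ h₁ h₂ ⟩
  (u + y) + (v + z) ≡⟨ regroup′ u y v z ⟩
  u + z + (v + y)   ∎))
  where
  open ≡-Reasoning
  regroup : ∀ a b c d → a + b + (c + d) ≡ (a + c) + (d + b)
  regroup = solve-∀
  regroup′ : ∀ a b c d → (a + b) + (c + d) ≡ a + d + (c + b)
  regroup′ = solve-∀

⊖≈-swap : ∀ {x y u v} → x ⊖ y ≈ u ⊖ v → x ⊖ u ≈ y ⊖ v
⊖≈-swap {y = y} {u} (mk⊖≈ h) = mk⊖≈ (trans h (+-comm u y))

⊖≈-trans : ∀ {x y u v s t} → x ⊖ y ≈ u ⊖ v → u ⊖ v ≈ s ⊖ t → x ⊖ y ≈ s ⊖ t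
⊖≈-trans h₁ h₂ = ⊖≈-swap (⊖≈-telescope (⊖≈-swap h₁) (⊖≈-swap h₂))

⊖≈-cancel : ∀ {x y x′ y′ u v} → x ⊖ y ≈ u ⊖ v → x′ ⊖ y′ ≈ v ⊖ u → x + x′ ≡ y + y′
⊖≈-cancel {x} {y} {x′} {y′} {u} {v} (mk⊖≈ h₁) (mk⊖≈ h₂) = +-cancelʳ-≡ (u + v) _ _ (begin
  x + x′ + (u + v)    ≡⟨ regroup x x′ u v ⟩
  (x + v) + (x′ + u)  ≡⟨ cong₂ _+_ h₁ h₂ ⟩
  (u + y) + (v + y′)  ≡⟨ regroup′ u y v y′ ⟩
  y + y′ + (u + v)    ∎)
  where
  open ≡-Reasoning
  regroup : ∀ a b c d → a + b + (c + d) ≡ (a + d) + (b + c)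
  regroup = solve-∀
  regroup′ : ∀ a b c d → (a + b) + (c + d) ≡ b + d + (a + c)
  regroup′ = solve-∀

sumFin-update : ∀ {n} (f g : Fin n → ℕ) j → (∀ k → k ≢ j → f k ≡ g k) →
                sumFin f ⊖ sumFin g ≈ f j ⊖ g j
sumFin-update f g zero h
  rewrite sumFin-cong {f = f ∘ suc} {g = g ∘ suc} (λ k → h (suc k) (λ ()))
  = mk⊖≈ (assoc-comm (f zero) (sumFin (g ∘ suc)) (g zero))
  where
  assoc-comm : ∀ a b c → a + b + c ≡ a + (c + b)
  assoc-comm = solve-∀
sumFin-update f g (suc j) h = mk⊖≈ (begin
  f zero + sumFin (f ∘ suc) + g (suc j)   ≡⟨ +-assoc (f zero) _ _ ⟩
  f zero + (sumFin (f ∘ suc) + g (suc j)) ≡⟨ cong (f zero +_) (cross tail-update) ⟩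
  f zero + (f (suc j) + sumFin (g ∘ suc)) ≡⟨ x+[y+z]≡y+[x+z] (f zero) (f (suc j)) (sumFin (g ∘ suc)) ⟩
  f (suc j) + (f zero + sumFin (g ∘ suc))
    ≡⟨ cong (λ a → f (suc j) + (a + sumFin (g ∘ suc))) (h zero (λ ())) ⟩
  f (suc j) + (g zero + sumFin (g ∘ suc)) ∎)
  where
  open ≡-Reasoning
  tail-update = sumFin-update (f ∘ suc) (g ∘ suc) j (λ k k≢j → h (suc k) (k≢j ∘ Fin.suc-injective))
  x+[y+z]≡y+[x+z] : ∀ x y z → x + (y + z) ≡ y + (x + z)
  x+[y+z]≡y+[x+z] = solve-∀

sumFin-update₂ : ∀ {m n} (F G : Fin m → Fin n → ℕ) j j′ →
                 (∀ k k′ → (k , k′) ≢ (j , j′) → F k k′ ≡ G k k′) →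
                 sumFin (λ k → sumFin (F k)) ⊖ sumFin (λ k → sumFin (G k)) ≈ F j j′ ⊖ G j j′
sumFin-update₂ F G j j′ h =
  ⊖≈-trans
    (sumFin-update _ _ j (λ k k≢j → sumFin-cong (λ k′ → h k k′ (k≢j ∘ cong proj₁))))
    (sumFin-update (F j) (G j) j′ (λ k′ k′≢j′ → h j k′ (k′≢j′ ∘ cong proj₂)))

guard-0 : ∀ b → guard b 0 ≡ 0
guard-0 true  = refl
guard-0 false = refl

guard-≤ : ∀ b n → guard b n ≤ n
guard-≤ true  n = ≤-refl
guard-≤ false n = z≤n

guard-+ : ∀ b m n → guard b (m + n) ≡ guard b m + guard b n
guard-+ true  m n = refl
guard-+ false m n = refl

guard-sumFin : ∀ {n} b (f : Fin n → ℕ) → guard b (sumFin f) ≡ sumFin (λ x → guard b (f x))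
guard-sumFin {n} true  f = refl
guard-sumFin {n} false f = sym (sumFin-zero n)

sumFin-guard-const : ∀ {n} k (b : Fin n → Bool) → sumFin (λ x → guard (b x) k) ≡ k * count b
sumFin-guard-const k b =
  trans (sumFin-cong (λ x → guard-as-* (b x))) (sym (*-distribˡ-sumFin k (λ x → guard (b x) 1)))
  where
  guard-as-* : ∀ c → guard c k ≡ k * guard c 1
  guard-as-* true  = sym (*-identityʳ k)
  guard-as-* false = sym (*-zeroʳ k)

infix 4 _⊆_
_⊆_ : ∀ {n} → (Fin n → Bool) → (Fin n → Bool) → Set
f ⊆ g = ∀ x → f x ≡ true → g x ≡ true

indicator-mono : ∀ {a b} → (a ≡ true → b ≡ true) → guard a 1 ≤ guard b 1
indicator-mono {false}         a⇒b = z≤n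
indicator-mono {true} {true}   a⇒b = ≤-refl
indicator-mono {true} {false}  a⇒b with () ← a⇒b refl

count-≤ : ∀ {n} (f : Fin n → Bool) → count f ≤ n
count-≤ {n} f = ≤-trans (sumFin-mono-≤ (λ x → guard-≤ (f x) 1)) (≤-reflexive (sumFin-one n))

count-mono : ∀ {n} {f g : Fin n → Bool} → f ⊆ g → count f ≤ count g
count-mono f⊆g = sumFin-mono-≤ (λ x → indicator-mono (f⊆g x))

count-≤⇒⊇ : ∀ {n} {f g : Fin n → Bool} → f ⊆ g → count g ≤ count f → g ⊆ f
count-≤⇒⊇ {f = f} {g} f⊆g count≤ x gx with f x in fx
... | true  = refl
... | false = ⊥-elim (≤⇒≯ count≤ (sumFin-mono-< (λ y → indicator-mono (f⊆g y)) x fx<gx))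
  where
  fx<gx : guard (f x) 1 < guard (g x) 1
  fx<gx rewrite fx | gx = ≤-refl

∧-true : ∀ a {b} → a ∧ b ≡ true → a ≡ true × b ≡ true
∧-true true {true} _ = refl , refl

∨-introʳ : ∀ a {b} → b ≡ true → a ∨ b ≡ true
∨-introʳ a refl = ∨-zeroʳ a

anyFin-sound : ∀ {n} (f : Fin n → Bool) → anyFin f ≡ true → ∃ λ k → f k ≡ true
anyFin-sound {suc n} f h with f zero in f0
... | true  = zero , f0
... | false with k , fk ← anyFin-sound (f ∘ suc) h = suc k , fk

anyFin-complete : ∀ {n} (f : Fin n → Bool) k → f k ≡ true → anyFin f ≡ true
anyFin-complete f zero    fk rewrite fk = refl
anyFin-complete f (suc k) fk rewrite anyFin-complete (f ∘ suc) k fk = ∨-zeroʳ (f zero)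

anyFin-false : ∀ {n} (f : Fin n → Bool) → anyFin f ≡ false → ∀ k → f k ≡ false
anyFin-false f none k with f k in fk
... | true  = trans (sym (anyFin-complete f k fk)) none
... | false = refl

anyFin-mono : ∀ {n} {f g : Fin n → Bool} → f ⊆ g → anyFin f ≡ true → anyFin g ≡ true
anyFin-mono {f = f} {g} f⊆g h with k , fk ← anyFin-sound f h = anyFin-complete g k (f⊆g k fk)

positive-elsewhere-or-sumFin≤ : ∀ {n} (f : Fin n → ℕ) j →
  (∃ λ k → k ≢ j × 0 < f k) ⊎ sumFin f ≤ f j
positive-elsewhere-or-sumFin≤ {n} f j
  with Fin.any? (λ k → ¬? (k Fin.≟ j) ×-dec (0 <? f k))
... | yes witness = inj₁ witness
... | no  none    = inj₂ (≤-reflexive (begin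
  sumFin f                    ≡⟨ +-identityʳ (sumFin f) ⟨
  sumFin f + 0                ≡⟨ cross (sumFin-update f (λ _ → 0) j vanish) ⟩
  f j + sumFin {n} (λ _ → 0)  ≡⟨ cong (f j +_) (sumFin-zero n) ⟩
  f j + 0                     ≡⟨ +-identityʳ (f j) ⟩
  f j                         ∎))
  where
  open ≡-Reasoning
  vanish : ∀ k → k ≢ j → f k ≡ 0
  vanish k k≢j = n≤0⇒n≡0 (≮⇒≥ (λ pos → none (k , k≢j , pos)))

0<sumFin : ∀ {n} (f : Fin n → ℕ) j → 0 < f j → 0 < sumFin f
0<sumFin {n} f j pos = subst (_< sumFin f) (sumFin-zero n) (sumFin-mono-< (λ _ → z≤n) j pos)

-- Out-degrees and the pebble invariant

module _ {np nl : ℕ} where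

  =V-sound : (x y : Vertex np nl) → x =V y ≡ true → x ≡ y
  =V-sound (inj₁ p) (inj₁ q) h with p Fin.≟ q
  ... | yes refl = refl
  =V-sound (inj₂ a) (inj₂ b) h with a Fin.≟ b
  ... | yes refl = refl

  =V-refl : (x : Vertex np nl) → x =V x ≡ true
  =V-refl (inj₁ p) with p Fin.≟ p
  ... | yes _   = refl
  ... | no  p≢p = ⊥-elim (p≢p refl)
  =V-refl (inj₂ a) with a Fin.≟ a
  ... | yes _   = refl
  ... | no  a≢a = ⊥-elim (a≢a refl)

  δ : Vertex np nl → Vertex np nl → ℕ
  δ x y = guard (x =V y) 1

  =V-≢ : (x y : Vertex np nl) → x ≢ y → x =V y ≡ false
  =V-≢ x y x≢y with x =V y in eq
  ... | true  = ⊥-elim (x≢y (=V-sound x y eq))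
  ... | false = refl

module _ {np nl lam : ℕ} where

  =E-sound : (e f : Edge np nl lam) → e =E f ≡ true → e ≡ f
  =E-sound (p , ℓ , i) (q , m , j) h with p Fin.≟ q | ℓ Fin.≟ m | i Fin.≟ j
  ... | yes refl | yes refl | yes refl = refl

  =E-refl : (e : Edge np nl lam) → e =E e ≡ true
  =E-refl (p , ℓ , i) with p Fin.≟ p | ℓ Fin.≟ ℓ | i Fin.≟ i
  ... | yes _ | yes _ | yes _ = refl
  ... | no p≢p | _     | _     = ⊥-elim (p≢p refl)
  ... | yes _  | no ≢ℓ | _     = ⊥-elim (≢ℓ refl)
  ... | yes _  | yes _ | no ≢i = ⊥-elim (≢i refl)

  =E-≢ : (e f : Edge np nl lam) → e ≢ f → e =E f ≡ false
  =E-≢ e f e≢f with e =E f in eq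
  ... | true  = ⊥-elim (e≢f (=E-sound e f eq))
  ... | false = refl

Orientation : ℕ → ℕ → ℕ → Set
Orientation np nl lam = Fin np → Fin nl → Fin lam → Maybe Dir

at : ∀ {np nl lam} → Orientation np nl lam → Edge np nl lam → Maybe Dir
at a (p , ℓ , i) = a p ℓ i

fromP fromL : Maybe Dir → ℕ
fromP (just P→L) = 1
fromP _          = 0
fromL (just L→P) = 1
fromL _          = 0

tail : ∀ {np nl lam} → Dir → Edge np nl lam → Vertex np nl
tail P→L (p , ℓ , i) = inj₁ p
tail L→P (p , ℓ , i) = inj₂ ℓ

module _ {np nl lam : ℕ} where

  outdegree : Orientation np nl lam → Vertex np nl → ℕ
  outdegree a (inj₁ q) = sumFin λ ℓ → sumFin λ i → fromP (a q ℓ i)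
  outdegree a (inj₂ m) = sumFin λ p → sumFin λ i → fromL (a p m i)

  tailCount : Vertex np nl → Edge np nl lam → Maybe Dir → ℕ
  tailCount x (p , ℓ , i) d = guard (x =V inj₁ p) (fromP d) + guard (x =V inj₂ ℓ) (fromL d)

  tailCount-nothing : ∀ x e → tailCount x e nothing ≡ 0
  tailCount-nothing x (p , ℓ , i) = cong₂ _+_ (guard-0 (x =V inj₁ p)) (guard-0 (x =V inj₂ ℓ))

  tailCount-just : ∀ x e d → tailCount x e (just d) ≡ δ x (tail d e)
  tailCount-just x (p , ℓ , i) P→L =
    trans (cong (δ x (inj₁ p) +_) (guard-0 (x =V inj₂ ℓ))) (+-identityʳ _)
  tailCount-just x (p , ℓ , i) L→P = cong (_+ δ x (inj₂ ℓ)) (guard-0 (x =V inj₁ p))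

  outdegree-cong : ∀ {a b : Orientation np nl lam} → (∀ p ℓ i → a p ℓ i ≡ b p ℓ i) →
                   ∀ x → outdegree a x ≡ outdegree b x
  outdegree-cong a≗b (inj₁ q) = sumFin-cong λ ℓ → sumFin-cong λ i → cong fromP (a≗b q ℓ i)
  outdegree-cong a≗b (inj₂ m) = sumFin-cong λ p → sumFin-cong λ i → cong fromL (a≗b p m i)

  setAcc-here : ∀ (a : Orientation np nl lam) e d → at (setAcc a e d) e ≡ d
  setAcc-here a e@(p , ℓ , i) d rewrite =E-refl e = refl

  setAcc-elsewhere : ∀ (a : Orientation np nl lam) e d p ℓ i → (p , ℓ , i) ≢ e →
                     setAcc a e d p ℓ i ≡ a p ℓ i
  setAcc-elsewhere a e d p ℓ i ≢e rewrite =E-≢ (p , ℓ , i) e ≢e = refl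

  outdegree-update : ∀ (a a′ : Orientation np nl lam) e →
    (∀ p ℓ i → (p , ℓ , i) ≢ e → a′ p ℓ i ≡ a p ℓ i) →
    ∀ x → outdegree a′ x ⊖ outdegree a x ≈ tailCount x e (at a′ e) ⊖ tailCount x e (at a e)
  outdegree-update a a′ (p , ℓ , i) off (inj₁ q) with q Fin.≟ p
  ... | yes refl
    rewrite +-identityʳ (fromP (a q ℓ i)) | +-identityʳ (fromP (a′ q ℓ i))
    = sumFin-update₂ (λ k k′ → fromP (a′ q k k′)) (λ k k′ → fromP (a q k k′)) ℓ i
        (λ k k′ ≢ℓi → cong fromP (off q k k′ (≢ℓi ∘ cong proj₂)))
  ... | no q≢p = mk⊖≈ (trans (+-identityʳ _) (sumFin-cong λ k → sumFin-cong λ k′ →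
                   cong fromP (off q k k′ (q≢p ∘ cong proj₁))))
  outdegree-update a a′ (p , ℓ , i) off (inj₂ m) with m Fin.≟ ℓ
  ... | yes refl
    = sumFin-update₂ (λ k k′ → fromL (a′ k m k′)) (λ k k′ → fromL (a k m k′)) p i
        (λ k k′ ≢pi → cong fromL (off k m k′ (≢pi ∘ cong λ { (x , _ , z) → x , z })))
  ... | no m≢ℓ = mk⊖≈ (trans (+-identityʳ _) (sumFin-cong λ k → sumFin-cong λ k′ →
                   cong fromL (off k m k′ (m≢ℓ ∘ cong (proj₁ ∘ proj₂)))))

  outdegree-setAcc : ∀ (a : Orientation np nl lam) e d x →
    outdegree (setAcc a e d) x ⊖ outdegree a x ≈ tailCount x e d ⊖ tailCount x e (at a e)
  outdegree-setAcc a e d x =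
    subst (λ s → outdegree (setAcc a e d) x ⊖ outdegree a x ≈ tailCount x e s ⊖ tailCount x e (at a e))
      (setAcc-here a e d) (outdegree-update a (setAcc a e d) e (setAcc-elsewhere a e d) x)

  outdegree-accept : ∀ (a : Orientation np nl lam) e d x → at a e ≡ nothing →
    outdegree (setAcc a e (just d)) x ⊖ outdegree a x ≈ δ x (tail d e) ⊖ 0
  outdegree-accept a e d x free =
    subst₂ (λ t s → outdegree (setAcc a e (just d)) x ⊖ outdegree a x ≈ t ⊖ s)
      (tailCount-just x e d) (trans (cong (tailCount x e) free) (tailCount-nothing x e))
      (outdegree-setAcc a e (just d) x)

  outdegree-reorient : ∀ (a : Orientation np nl lam) e d₀ d x → at a e ≡ just d₀ →
    outdegree (setAcc a e (just d)) x ⊖ outdegree a x ≈ δ x (tail d e) ⊖ δ x (tail d₀ e)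
  outdegree-reorient a e d₀ d x at≡ =
    subst₂ (λ t s → outdegree (setAcc a e (just d)) x ⊖ outdegree a x ≈ t ⊖ s)
      (tailCount-just x e d) (trans (cong (tailCount x e) at≡) (tailCount-just x e d₀))
      (outdegree-setAcc a e (just d) x)

  arc-view : ∀ {c : Config np nl lam} {u e v} → Arc c u e v →
             ∃ λ d → at (acc c) e ≡ just d × u ≡ tail d e × v ≡ tail (flipDir d) e
  arc-view (pl p ℓ i eq) = P→L , eq , refl , refl
  arc-view (lp p ℓ i eq) = L→P , eq , refl , refl

  arc-retarget : ∀ {c c′ : Config np nl lam} {u e v} → at (acc c′) e ≡ at (acc c) e →
                 Arc c u e v → Arc c′ u e v
  arc-retarget same (pl p ℓ i eq) = pl p ℓ i (trans same eq)
  arc-retarget same (lp p ℓ i eq) = lp p ℓ i (trans same eq)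

  elemE-here : ∀ (e : Edge np nl lam) es → elemE e (e ∷ es) ≡ true
  elemE-here e es rewrite =E-refl e = refl

  elemE-there : ∀ (e′ e : Edge np nl lam) es → elemE e′ es ≡ true → elemE e′ (e ∷ es) ≡ true
  elemE-there e′ e es h rewrite h = ∨-zeroʳ (e′ =E e)

  data Trail (c : Config np nl lam) : Vertex np nl → List (Edge np nl lam) → Vertex np nl → Set where
    []     : ∀ {v} → Trail c v [] v
    _∷⟨_⟩_ : ∀ {u e v es w} → Arc c u e v → elemE e es ≡ false → Trail c v es w →
             Trail c u (e ∷ es) w

  trail-retarget : ∀ {c c′ : Config np nl lam} {v es w} →
    (∀ e′ → elemE e′ es ≡ true → at (acc c′) e′ ≡ at (acc c) e′) → Trail c v es w → Trail c′ v es w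
  trail-retarget same [] = []
  trail-retarget {es = e ∷ es} same (α ∷⟨ e∉es ⟩ τ) =
    arc-retarget (same e (elemE-here e es)) α ∷⟨ e∉es ⟩
    trail-retarget (λ e′ e′∈es → same e′ (elemE-there e′ e es e′∈es)) τ

  reverseEdges-∷ : ∀ (a : Orientation np nl lam) e es d → at a e ≡ just d → elemE e es ≡ false →
    ∀ p ℓ i → reverseEdges a (e ∷ es) p ℓ i ≡ reverseEdges (setAcc a e (just (flipDir d))) es p ℓ i
  reverseEdges-∷ a e es d at≡ e∉es p ℓ i with (p , ℓ , i) =E e in eq
  ... | true  with refl ← =E-sound (p , ℓ , i) e eq rewrite e∉es | at≡ = refl
  ... | false = refl

  setAcc-∉ : ∀ (a : Orientation np nl lam) e es d → elemE e es ≡ false →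
    ∀ e′ → elemE e′ es ≡ true → at (setAcc a e d) e′ ≡ at a e′
  setAcc-∉ a e es d e∉es e′@(p , ℓ , i) e′∈es =
    setAcc-elsewhere a e d p ℓ i λ { refl → contradiction (trans (sym e′∈es) e∉es) λ () }

  trail-reversal : ∀ {c : Config np nl lam} {v es w} → Trail c v es w →
    ∀ x → outdegree (reverseEdges (acc c) es) x ⊖ outdegree (acc c) x ≈ δ x w ⊖ δ x v
  trail-reversal {c} {v} [] x = mk⊖≈ (+-comm (outdegree (acc c) x) (δ x v))
  trail-reversal {c} {es = e ∷ es} {w} (α ∷⟨ e∉es ⟩ τ) x with arc-view α
  ... | d , at≡ , refl , refl =
    ⊖≈-telescope
      (subst (λ o → o ⊖ outdegree a′ x ≈ δ x w ⊖ δ x (tail (flipDir d) e))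
             (sym (outdegree-cong (reverseEdges-∷ a e es d at≡ e∉es) x))
             (trail-reversal (trail-retarget {c′ = record c { acc = a′ }}
                                             (setAcc-∉ a e es (just (flipDir d)) e∉es) τ) x))
      (outdegree-reorient a e d (flipDir d) x at≡)
    where
    a  = acc c
    a′ = setAcc a e (just (flipDir d))

  arc-tail-unique : ∀ {c : Config np nl lam} {u u′ e v v′} → Arc c u e v → Arc c u′ e v′ → u ≡ u′
  arc-tail-unique α α′ with arc-view α | arc-view α′
  ... | d , at≡ , refl , _ | d′ , at≡′ , refl , _ =
    cong (λ d → tail d _) (just-injective (trans (sym at≡) at≡′))

  walkEdge-arc : ∀ {c : Config np nl lam} {v w} e (ws : Walk c v w) → elemE e (walkEdges ws) ≡ true →
    ∃ λ u → ∃ λ u′ → Arc c u e u′ × u ∈ walkVertices ws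
  walkEdge-arc e (_∷_ {u} {f} {v} α ws) e∈ with e =E f in eq
  ... | true  with refl ← =E-sound e f eq = u , v , α , here refl
  ... | false with u′ , v′ , α′ , u′∈ ← walkEdge-arc e ws e∈ = u′ , v′ , α′ , there u′∈

  path-trail : ∀ {c : Config np nl lam} {v w} (ws : Walk c v w) → Unique (walkVertices ws) →
               Trail c v (walkEdges ws) w
  path-trail []        _          = []
  path-trail (_∷_ {e = e} α ws) (u∉ws ∷ uq) = α ∷⟨ fresh ⟩ path-trail ws uq
    where
    fresh : elemE e (walkEdges ws) ≡ false
    fresh with elemE e (walkEdges ws) in e∈
    ... | false = refl
    ... | true with u′ , _ , α′ , u′∈ws ← walkEdge-arc e ws e∈ =
      ⊥-elim (All.lookup u∉ws u′∈ws (arc-tail-unique α α′))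

module _ {np nl : ℕ} where

  adjust-pred : ∀ (f : Vertex np nl → ℕ) v → 0 < f v →
                ∀ x → adjust f v (λ n → n ∸ 1) x ⊖ f x ≈ 0 ⊖ δ x v
  adjust-pred f v pos x with x =V v in x=v
  ... | true with refl ← =V-sound x v x=v = mk⊖≈ (m∸n+n≡m pos)
  ... | false = mk⊖≈ (+-identityʳ (f x))

  adjust-transfer : ∀ (f : Vertex np nl → ℕ) v w → 0 < f w →
                    ∀ x → adjust (adjust f v suc) w (λ n → n ∸ 1) x ⊖ f x ≈ δ x v ⊖ δ x w
  adjust-transfer f v w pos x with x =V w in x=w | x =V v
  ... | true  | true  = mk⊖≈ (+-comm (f x) 1)
  ... | true  | false with refl ← =V-sound x w x=w = mk⊖≈ (m∸n+n≡m pos)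
  ... | false | true  = mk⊖≈ (+-identityʳ (suc (f x)))
  ... | false | false = mk⊖≈ (+-identityʳ (f x))

PebbleBalance : ∀ {np nl lam} → ℕ → ℕ → Config np nl lam → Set
PebbleBalance k₁ k₂ c = ∀ x → peb c x + outdegree (acc c) x ≡ kτ k₁ k₂ x

initial-balanced : ∀ {np nl lam} k₁ k₂ → PebbleBalance {np} {nl} {lam} k₁ k₂ (initial k₁ k₂)
initial-balanced {np} {nl} {lam} k₁ k₂ (inj₁ q) =
  trans (cong (k₁ +_) (trans (sumFin-cong {nl} λ _ → sumFin-zero lam) (sumFin-zero nl))) (+-identityʳ k₁)
initial-balanced {np} {nl} {lam} k₁ k₂ (inj₂ m) =
  trans (cong (k₂ +_) (trans (sumFin-cong {np} λ _ → sumFin-zero lam) (sumFin-zero np))) (+-identityʳ k₂)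

reverseEdges-is-just : ∀ {np nl lam} (a : Orientation np nl lam) es p ℓ i →
                       is-just (reverseEdges a es p ℓ i) ≡ is-just (a p ℓ i)
reverseEdges-is-just a es p ℓ i with elemE (p , ℓ , i) es | a p ℓ i
... | true  | just _  = refl
... | true  | nothing = refl
... | false | _       = refl

reverseEdges-nothing : ∀ {np nl lam} (a : Orientation np nl lam) es p ℓ i →
                       a p ℓ i ≡ nothing → reverseEdges a es p ℓ i ≡ nothing
reverseEdges-nothing a es p ℓ i free with elemE (p , ℓ , i) es
... | true  = cong (Maybe.map flipDir) free
... | false = free

setAcc-is-just : ∀ {np nl lam} (a : Orientation np nl lam) e d p ℓ i →
                 is-just (a p ℓ i) ≡ true → is-just (setAcc a e (just d) p ℓ i) ≡ true
setAcc-is-just a e d p ℓ i h with (p , ℓ , i) =E e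
... | true  = refl
... | false = h

sparse-⊆ : ∀ {np nl} {lam k₁ k₂ l} {J J′ : Incidences np nl} →
           J′ ⊆I J → Sparse lam k₁ k₂ l J → Sparse lam k₁ k₂ l J′
sparse-⊆ J′⊆J sparse J″ J″⊆J′ = sparse J″ (λ p ℓ → J′⊆J p ℓ ∘ J″⊆J′ p ℓ)

module _ {np nl} {I : Incidences np nl} {lam k₁ k₂ l : ℕ} where

  Moves-preserve : {P : Config np nl lam → Set} →
    (∀ {c c′} → Move I lam k₁ k₂ l c c′ → P c → P c′) →
    ∀ {c c′} → Moves I lam k₁ k₂ l c c′ → P c → P c′
  Moves-preserve {P} step = fold (λ c c′ → P c → P c′) (λ m rest → rest ∘ step m) id

  move-balanced : ∀ {c c′} → Move I lam k₁ k₂ l c c′ → PebbleBalance k₁ k₂ c → PebbleBalance k₁ k₂ c′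
  move-balanced {c} (accept-P p ℓ i _ free _ pos) balanced x =
    trans (⊖≈-cancel (adjust-pred (peb c) (inj₁ p) pos x)
                     (outdegree-accept (acc c) (p , ℓ , i) P→L x free))
          (balanced x)
  move-balanced {c} (accept-L p ℓ i _ free _ pos) balanced x =
    trans (⊖≈-cancel (adjust-pred (peb c) (inj₂ ℓ) pos x)
                     (outdegree-accept (acc c) (p , ℓ , i) L→P x free))
          (balanced x)
  move-balanced {c} (move-pebble v w π pos) balanced x =
    trans (⊖≈-cancel (adjust-transfer (peb c) v w pos x)
                     (trail-reversal (path-trail (walk π) (simple π)) x))
          (balanced x)

  move-keeps-accepted : ∀ {c c′} → Move I lam k₁ k₂ l c c′ →
    ∀ p ℓ i → is-just (acc c p ℓ i) ≡ true → is-just (acc c′ p ℓ i) ≡ true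
  move-keeps-accepted {c} (accept-P p₁ ℓ₁ i₁ _ _ _ _) = setAcc-is-just (acc c) (p₁ , ℓ₁ , i₁) P→L
  move-keeps-accepted {c} (accept-L p₁ ℓ₁ i₁ _ _ _ _) = setAcc-is-just (acc c) (p₁ , ℓ₁ , i₁) L→P
  move-keeps-accepted {c} (move-pebble v w π _) p ℓ i =
    trans (reverseEdges-is-just (acc c) (walkEdges (walk π)) p ℓ i)

  AcceptedWithin : Config np nl lam → Set
  AcceptedWithin c = ∀ p ℓ i → is-just (acc c p ℓ i) ≡ true → I p ℓ ≡ true

  move-accepted-within : ∀ {c c′} → Move I lam k₁ k₂ l c c′ → AcceptedWithin c → AcceptedWithin c′
  move-accepted-within {c} (accept-P p₁ ℓ₁ i₁ I₁ _ _ _) within p ℓ i h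
    with (p , ℓ , i) =E (p₁ , ℓ₁ , i₁) in eq
  ... | true with refl ← =E-sound (p , ℓ , i) (p₁ , ℓ₁ , i₁) eq = I₁
  ... | false = within p ℓ i h
  move-accepted-within {c} (accept-L p₁ ℓ₁ i₁ I₁ _ _ _) within p ℓ i h
    with (p , ℓ , i) =E (p₁ , ℓ₁ , i₁) in eq
  ... | true with refl ← =E-sound (p , ℓ , i) (p₁ , ℓ₁ , i₁) eq = I₁
  ... | false = within p ℓ i h
  move-accepted-within {c} (move-pebble v w π _) within p ℓ i h =
    within p ℓ i (trans (sym (reverseEdges-is-just (acc c) (walkEdges (walk π)) p ℓ i)) h)

-- Paths and reachability

module _ {np nl lam : ℕ} {c : Config np nl lam} where

  open import Data.List.Membership.DecPropositional (Sum.≡-dec (Fin._≟_ {np}) (Fin._≟_ {nl}))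
    using (_∈?_)

  _∷ʳ_ : ∀ {u v e w} → Walk c u v → Arc c v e w → Walk c u w
  []       ∷ʳ α = α ∷ []
  (β ∷ ws) ∷ʳ α = β ∷ (ws ∷ʳ α)

  path-suffix : ∀ {v w} (π : Path c v w) {u} → u ∈ walkVertices (walk π) → Path c u w
  path-suffix (path []       simple)         (here refl) = path [] simple
  path-suffix (path (α ∷ ws) simple)         (here refl) = path (α ∷ ws) simple
  path-suffix (path (α ∷ ws) (_ ∷ simple))   (there u∈)  = path-suffix (path ws simple) u∈

  walk-path : ∀ {v w} → Walk c v w → Path c v w
  walk-path [] = path [] (All.[] ∷ [])
  walk-path (_∷_ {u} α ws) with walk-path ws
  ... | π with u ∈? walkVertices (walk π)
  ...   | yes u∈π = path-suffix π u∈π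
  ...   | no  u∉π = path (α ∷ walk π) (¬Any⇒All¬ (walkVertices (walk π)) u∉π ∷ simple π)

VertexSet : ℕ → ℕ → Set
VertexSet np nl = (Fin np → Bool) × (Fin nl → Bool)

module _ {np nl : ℕ} where

  member : VertexSet np nl → Vertex np nl → Bool
  member (RP , RL) (inj₁ p) = RP p
  member (RP , RL) (inj₂ ℓ) = RL ℓ

  infix 4 _⊆ᵛ_
  _⊆ᵛ_ : VertexSet np nl → VertexSet np nl → Set
  R ⊆ᵛ S = proj₁ R ⊆ proj₁ S × proj₂ R ⊆ proj₂ S

  ⊆ᵛ-trans : ∀ {R S T} → R ⊆ᵛ S → S ⊆ᵛ T → R ⊆ᵛ T
  ⊆ᵛ-trans (RP⊆SP , RL⊆SL) (SP⊆TP , SL⊆TL) =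
    (λ p → SP⊆TP p ∘ RP⊆SP p) , (λ ℓ → SL⊆TL ℓ ∘ RL⊆SL ℓ)

  card : VertexSet np nl → ℕ
  card (RP , RL) = count RP + count RL

  card-≤ : ∀ R → card R ≤ np + nl
  card-≤ (RP , RL) = +-mono-≤ (count-≤ RP) (count-≤ RL)

  card-≤⇒⊇ : ∀ {R S} → R ⊆ᵛ S → card S ≤ card R → S ⊆ᵛ R
  card-≤⇒⊇ {RP , RL} {SP , SL} (RP⊆SP , RL⊆SL) S≤R =
    count-≤⇒⊇ RP⊆SP
      (+-cancelʳ-≤ (count SL) _ _ (≤-trans S≤R (+-monoʳ-≤ (count RP) (count-mono RL⊆SL)))) ,
    count-≤⇒⊇ RL⊆SL
      (+-cancelˡ-≤ (count SP) _ _ (≤-trans S≤R (+-monoˡ-≤ (count RL) (count-mono RP⊆SP))))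

oriented : Dir → Maybe Dir → Bool
oriented P→L (just P→L) = true
oriented L→P (just L→P) = true
oriented _   _          = false

oriented-sound : ∀ d m → oriented d m ≡ true → m ≡ just d
oriented-sound P→L (just P→L) _ = refl
oriented-sound L→P (just L→P) _ = refl

module Reachability {np nl lam : ℕ} (c : Config np nl lam) where

  Closed : VertexSet np nl → Set
  Closed R = ∀ {u e v} → Arc c u e v → member R u ≡ true → member R v ≡ true

  ReachableFrom : VertexSet np nl → VertexSet np nl → Set
  ReachableFrom S R = ∀ v → member R v ≡ true → ∃ λ s → member S s ≡ true × Walk c s v

  expand : VertexSet np nl → VertexSet np nl
  expand (RP , RL) =
    (λ p → RP p ∨ anyFin (λ ℓ → RL ℓ ∧ anyFin (λ i → oriented L→P (acc c p ℓ i)))) ,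
    (λ ℓ → RL ℓ ∨ anyFin (λ p → RP p ∧ anyFin (λ i → oriented P→L (acc c p ℓ i))))

  expand-⊇ : ∀ R → R ⊆ᵛ expand R
  expand-⊇ (RP , RL) = (λ p h → cong (_∨ _) h) , (λ ℓ h → cong (_∨ _) h)

  stable-closed : ∀ R → expand R ⊆ᵛ R → Closed R
  stable-closed (RP , RL) (stableP , stableL) (pl p ℓ i eq) RPp =
    stableL ℓ (∨-introʳ (RL ℓ) (anyFin-complete _ p (cong₂ _∧_ RPp
      (anyFin-complete _ i (cong (oriented P→L) eq)))))
  stable-closed (RP , RL) (stableP , stableL) (lp p ℓ i eq) RLℓ =
    stableP p (∨-introʳ (RP p) (anyFin-complete _ ℓ (cong₂ _∧_ RLℓ
      (anyFin-complete _ i (cong (oriented L→P) eq)))))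

  expand-reachable : ∀ {S R} → ReachableFrom S R → ReachableFrom S (expand R)
  expand-reachable {R = RP , RL} reach (inj₁ p) h with RP p in RPp
  ... | true = reach (inj₁ p) RPp
  ... | false
    with ℓ , hℓ ← anyFin-sound _ h
    with RLℓ , hi ← ∧-true (RL ℓ) hℓ
    with i , eq ← anyFin-sound _ hi
    with s , Ss , ws ← reach (inj₂ ℓ) RLℓ
    = s , Ss , ws ∷ʳ lp p ℓ i (oriented-sound L→P _ eq)
  expand-reachable {R = RP , RL} reach (inj₂ ℓ) h with RL ℓ in RLℓ
  ... | true = reach (inj₂ ℓ) RLℓ
  ... | false
    with p , hp ← anyFin-sound _ h
    with RPp , hi ← ∧-true (RP p) hp
    with i , eq ← anyFin-sound _ hi
    with s , Ss , ws ← reach (inj₁ p) RPp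
    = s , Ss , ws ∷ʳ pl p ℓ i (oriented-sound P→L _ eq)

  iterate : ℕ → VertexSet np nl → VertexSet np nl
  iterate zero    R = R
  iterate (suc n) R with card (expand R) ≤? card R
  ... | yes _ = R
  ... | no  _ = iterate n (expand R)

  iterate-preserves : (P : VertexSet np nl → Set) → (∀ {R} → P R → P (expand R)) →
                      ∀ n {R} → P R → P (iterate n R)
  iterate-preserves P step zero    PR = PR
  iterate-preserves P step (suc n) {R} PR with card (expand R) ≤? card R
  ... | yes _ = PR
  ... | no  _ = iterate-preserves P step n (step PR)

  iterate-stable-or-large : ∀ n R → expand (iterate n R) ⊆ᵛ iterate n R ⊎ n + card R ≤ card (iterate n R)
  iterate-stable-or-large zero    R = inj₂ ≤-refl
  iterate-stable-or-large (suc n) R with card (expand R) ≤? card R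
  ... | yes small = inj₁ (card-≤⇒⊇ (expand-⊇ R) small)
  ... | no  grows with iterate-stable-or-large n (expand R)
  ...   | inj₁ stable = inj₁ stable
  ...   | inj₂ large  = inj₂ (begin
    suc n + card R      ≡⟨ +-suc n (card R) ⟨
    n + suc (card R)    ≤⟨ +-monoʳ-≤ n (≰⇒> grows) ⟩
    n + card (expand R) ≤⟨ large ⟩
    card (iterate n (expand R)) ∎)
    where open ≤-Reasoning

  closure : VertexSet np nl → VertexSet np nl
  closure = iterate (suc (np + nl))

  closure-⊇ : ∀ S → S ⊆ᵛ closure S
  closure-⊇ S = iterate-preserves (S ⊆ᵛ_) (λ {R} S⊆R → ⊆ᵛ-trans S⊆R (expand-⊇ R)) _
    ((λ _ h → h) , (λ _ h → h))

  closure-reachable : ∀ S → ReachableFrom S (closure S)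
  closure-reachable S = iterate-preserves (ReachableFrom S) expand-reachable _
    (λ v Sv → v , Sv , [])

  closure-closed : ∀ S → Closed (closure S)
  closure-closed S with iterate-stable-or-large (suc (np + nl)) S
  ... | inj₁ stable = stable-closed (closure S) stable
  ... | inj₂ large  = ⊥-elim (<⇒≱ (s≤s (m≤m+n (np + nl) (card S))) (≤-trans large (card-≤ (closure S))))

-- Counting pebbles on a closed set of vertices

present : Maybe Dir → ℕ
present (just _) = 1
present nothing  = 0

pebblesOn : ∀ {np nl lam} → Config np nl lam → VertexSet np nl → ℕ
pebblesOn c (RP , RL) = sumFin (λ p → guard (RP p) (peb c (inj₁ p))) +
                        sumFin (λ ℓ → guard (RL ℓ) (peb c (inj₂ ℓ)))

module ClosedSetPebbles {np nl lam : ℕ} {k₁ k₂ l : ℕ} (c : Config np nl lam)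
  (balanced : PebbleBalance k₁ k₂ c) (sparse : Sparse lam k₁ k₂ l (ID c))
  (RP : Fin np → Bool) (RL : Fin nl → Bool) (closed : Reachability.Closed c (RP , RL))
  {p₀ ℓ₀ i₀} (RPp₀ : RP p₀ ≡ true) (RLℓ₀ : RL ℓ₀ ≡ true)
  (ID₀ : ID c p₀ ℓ₀ ≡ true) (free : acc c p₀ ℓ₀ i₀ ≡ nothing) where

  a = acc c

  leaving : Fin np → Fin nl → Fin lam → ℕ
  leaving p ℓ i = guard (RP p) (fromP (a p ℓ i)) + guard (RL ℓ) (fromL (a p ℓ i))

  -- R is closed, so an arc with its tail in R has its head in R as well.
  leaving-≤ : ∀ p ℓ i → leaving p ℓ i ≤ guard (RP p) (guard (RL ℓ) (present (a p ℓ i)))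
  leaving-≤ p ℓ i with a p ℓ i in eq
  ... | nothing rewrite guard-0 (RP p) | guard-0 (RL ℓ) = z≤n
  ... | just P→L with RP p in RPp
  ...   | false rewrite guard-0 (RL ℓ) = z≤n
  ...   | true  rewrite closed (pl p ℓ i eq) RPp = ≤-refl
  leaving-≤ p ℓ i | just L→P with RL ℓ in RLℓ
  ...   | false rewrite guard-0 (RP p) = z≤n
  ...   | true  rewrite closed (lp p ℓ i eq) RLℓ = ≤-refl

  present-≤1 : ∀ m → present m ≤ 1
  present-≤1 (just _) = ≤-refl
  present-≤1 nothing  = z≤n

  present-sum-≤ : ∀ p ℓ → sumFin (λ i → present (a p ℓ i)) ≤ guard (ID c p ℓ) lam
  present-sum-≤ p ℓ with ID c p ℓ in IDpℓ
  ... | false = ≤-reflexive (trans (sumFin-cong absent) (sumFin-zero lam))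
    where
    absent : ∀ i → present (a p ℓ i) ≡ 0
    absent i with a p ℓ i | anyFin-false (λ i → is-just (a p ℓ i)) IDpℓ i
    ... | nothing | _ = refl
  ... | true =
    ≤-trans (sumFin-mono-≤ (λ i → present-≤1 (a p ℓ i))) (≤-reflexive (sumFin-one lam))

  present-sum-< : sumFin (λ i → present (a p₀ ℓ₀ i)) < lam
  present-sum-< =
    <-≤-trans (sumFin-mono-< (λ i → present-≤1 (a p₀ ℓ₀ i)) i₀ missing) (≤-reflexive (sumFin-one lam))
    where
    missing : present (a p₀ ℓ₀ i₀) < 1
    missing rewrite free = s≤s z≤n

  spanned : Incidences np nl
  spanned p ℓ = RP p ∧ (RL ℓ ∧ ID c p ℓ)

  leaving-sum-guard : ∀ p ℓ →
    sumFin (λ i → guard (RP p) (guard (RL ℓ) (present (a p ℓ i)))) ≡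
    guard (RP p) (guard (RL ℓ) (sumFin (λ i → present (a p ℓ i))))
  leaving-sum-guard p ℓ =
    sym (trans (cong (guard (RP p)) (guard-sumFin (RL ℓ) (λ i → present (a p ℓ i))))
               (guard-sumFin (RP p) (λ i → guard (RL ℓ) (present (a p ℓ i)))))

  leaving-sum-≤ : ∀ p ℓ → sumFin (leaving p ℓ) ≤ guard (spanned p ℓ) lam
  leaving-sum-≤ p ℓ = ≤-trans (sumFin-mono-≤ (leaving-≤ p ℓ))
    (≤-trans (≤-reflexive (leaving-sum-guard p ℓ)) (restrict (RP p) (RL ℓ)))
    where
    restrict : ∀ b₁ b₂ → guard b₁ (guard b₂ (sumFin (λ i → present (a p ℓ i)))) ≤
                         guard (b₁ ∧ (b₂ ∧ ID c p ℓ)) lam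
    restrict false _     = z≤n
    restrict true  false = z≤n
    restrict true  true  = present-sum-≤ p ℓ

  spanned₀ : spanned p₀ ℓ₀ ≡ true
  spanned₀ = cong₂ _∧_ RPp₀ (cong₂ _∧_ RLℓ₀ ID₀)

  leaving-sum-< : sumFin (leaving p₀ ℓ₀) < guard (spanned p₀ ℓ₀) lam
  leaving-sum-< = begin-strict
    sumFin (leaving p₀ ℓ₀)                ≤⟨ sumFin-mono-≤ (leaving-≤ p₀ ℓ₀) ⟩
    sumFin (λ i → guard (RP p₀) (guard (RL ℓ₀) (present (a p₀ ℓ₀ i))))
                                          ≡⟨ leaving-sum-guard p₀ ℓ₀ ⟩
    guard (RP p₀) (guard (RL ℓ₀) present₀)
                                          ≡⟨ cong₂ (λ b₁ b₂ → guard b₁ (guard b₂ present₀)) RPp₀ RLℓ₀ ⟩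
    present₀                              <⟨ present-sum-< ⟩
    lam                                   ≡⟨ cong (λ b → guard b lam) spanned₀ ⟨
    guard (spanned p₀ ℓ₀) lam             ∎
    where
    open ≤-Reasoning
    present₀ = sumFin (λ i → present (a p₀ ℓ₀ i))

  outdegreeOn : ℕ
  outdegreeOn = sumFin (λ p → guard (RP p) (outdegree a (inj₁ p))) +
                sumFin (λ ℓ → guard (RL ℓ) (outdegree a (inj₂ ℓ)))

  outdegreeOn-leaving : outdegreeOn ≡ sumFin λ p → sumFin λ ℓ → sumFin (leaving p ℓ)
  outdegreeOn-leaving = sym (begin
    sumFin (λ p → sumFin λ ℓ → sumFin (leaving p ℓ))
      ≡⟨ sumFin-cong (λ p → trans (sumFin-cong λ ℓ → sumFin-distrib-+ (fromR p ℓ) (toR p ℓ))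
                                  (sumFin-distrib-+ (fromR₂ p) (toR₂ p))) ⟩
    sumFin (λ p → sumFin (fromR₂ p) + sumFin (toR₂ p))
      ≡⟨ sumFin-distrib-+ (λ p → sumFin (fromR₂ p)) (λ p → sumFin (toR₂ p)) ⟩
    sumFin (λ p → sumFin (fromR₂ p)) + sumFin (λ p → sumFin (toR₂ p))
      ≡⟨ cong₂ _+_ (sumFin-cong λ p → sym (guard-sumFin₂ (RP p) λ ℓ i → fromP (a p ℓ i)))
                   (trans (sumFin-comm λ p ℓ → sumFin (toR p ℓ))
                          (sumFin-cong λ ℓ → sym (guard-sumFin₂ (RL ℓ) λ p i → fromL (a p ℓ i)))) ⟩
    outdegreeOn ∎)
    where
    open ≡-Reasoning
    fromR toR : Fin np → Fin nl → Fin lam → ℕ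
    fromR p ℓ i = guard (RP p) (fromP (a p ℓ i))
    toR   p ℓ i = guard (RL ℓ) (fromL (a p ℓ i))
    fromR₂ toR₂ : Fin np → Fin nl → ℕ
    fromR₂ p ℓ = sumFin (fromR p ℓ)
    toR₂   p ℓ = sumFin (toR p ℓ)
    guard-sumFin₂ : ∀ {m n} b (f : Fin m → Fin n → ℕ) →
      guard b (sumFin λ x → sumFin (f x)) ≡ sumFin λ x → sumFin λ y → guard b (f x y)
    guard-sumFin₂ b f =
      trans (guard-sumFin b (λ x → sumFin (f x))) (sumFin-cong λ x → guard-sumFin b (f x))

  pebbles+outdegree : pebblesOn c (RP , RL) + outdegreeOn ≡ k₁ * count RP + k₂ * count RL
  pebbles+outdegree = begin
    (PebP + PebL) + (OutP + OutL) ≡⟨ regroup PebP PebL OutP OutL ⟩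
    (PebP + OutP) + (PebL + OutL) ≡⟨ cong₂ _+_ (on-side RP (λ p → balanced (inj₁ p)))
                                               (on-side RL (λ ℓ → balanced (inj₂ ℓ))) ⟩
    k₁ * count RP + k₂ * count RL ∎
    where
    open ≡-Reasoning
    PebP = sumFin (λ p → guard (RP p) (peb c (inj₁ p)))
    PebL = sumFin (λ ℓ → guard (RL ℓ) (peb c (inj₂ ℓ)))
    OutP = sumFin (λ p → guard (RP p) (outdegree a (inj₁ p)))
    OutL = sumFin (λ ℓ → guard (RL ℓ) (outdegree a (inj₂ ℓ)))
    regroup : ∀ w x y z → (w + x) + (y + z) ≡ (w + y) + (x + z)
    regroup = solve-∀
    on-side : ∀ {n} {k} (S : Fin n → Bool) {f g : Fin n → ℕ} → (∀ x → f x + g x ≡ k) →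
              sumFin (λ x → guard (S x) (f x)) + sumFin (λ x → guard (S x) (g x)) ≡ k * count S
    on-side {k = k} S {f} {g} f+g≡k = begin
      sumFin (λ x → guard (S x) (f x)) + sumFin (λ x → guard (S x) (g x))
        ≡⟨ sumFin-distrib-+ (λ x → guard (S x) (f x)) (λ x → guard (S x) (g x)) ⟨
      sumFin (λ x → guard (S x) (f x) + guard (S x) (g x))
        ≡⟨ sumFin-cong (λ x → trans (sym (guard-+ (S x) (f x) (g x))) (cong (guard (S x)) (f+g≡k x))) ⟩
      sumFin (λ x → guard (S x) k)
        ≡⟨ sumFin-guard-const k S ⟩
      k * count S ∎

  spanned⊆ID : spanned ⊆I ID c
  spanned⊆ID p ℓ h = proj₂ (∧-true (RL ℓ) (proj₂ (∧-true (RP p) h)))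

  spanned-nonempty : 0 < size spanned
  spanned-nonempty = 0<sumFin _ p₀ (0<sumFin _ ℓ₀ (subst (λ b → 0 < guard b 1) (sym spanned₀) ≤-refl))

  spanned-points : numPoints spanned ≤ count RP
  spanned-points = count-mono λ p h → proj₁ (∧-true (RP p) (proj₂ (anyFin-sound (spanned p) h)))

  spanned-lines : numLines spanned ≤ count RL
  spanned-lines = count-mono λ ℓ h →
    let p , spanned-pℓ = anyFin-sound (λ p → spanned p ℓ) h
    in  proj₁ (∧-true (RL ℓ) (proj₂ (∧-true (RP p) spanned-pℓ)))

  leaving-total-< : (sumFin λ p → sumFin λ ℓ → sumFin (leaving p ℓ)) < lam * size spanned
  leaving-total-< = begin-strict
    (sumFin λ p → sumFin λ ℓ → sumFin (leaving p ℓ))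
      <⟨ sumFin-mono-< (λ p → sumFin-mono-≤ (leaving-sum-≤ p))
                       p₀ (sumFin-mono-< (leaving-sum-≤ p₀) ℓ₀ leaving-sum-<) ⟩
    (sumFin λ p → sumFin λ ℓ → guard (spanned p ℓ) lam)
      ≡⟨ sumFin-cong (λ p → sumFin-guard-const lam (spanned p)) ⟩
    sumFin (λ p → lam * count (spanned p))
      ≡⟨ *-distribˡ-sumFin lam (λ p → count (spanned p)) ⟨
    lam * size spanned ∎
    where open ≤-Reasoning

  pebbles-on-closed : l < pebblesOn c (RP , RL)
  pebbles-on-closed = +-cancelˡ-< outdegreeOn _ _ (begin-strict
    outdegreeOn + l
      ≡⟨ cong (_+ l) outdegreeOn-leaving ⟩
    (sumFin λ p → sumFin λ ℓ → sumFin (leaving p ℓ)) + l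
      <⟨ +-monoˡ-< l leaving-total-< ⟩
    lam * size spanned + l
      ≤⟨ sparse spanned spanned⊆ID spanned-nonempty ⟩
    k₁ * numPoints spanned + k₂ * numLines spanned
      ≤⟨ +-mono-≤ (*-monoʳ-≤ k₁ spanned-points) (*-monoʳ-≤ k₂ spanned-lines) ⟩
    k₁ * count RP + k₂ * count RL
      ≡⟨ pebbles+outdegree ⟨
    pebblesOn c (RP , RL) + outdegreeOn
      ≡⟨ +-comm (pebblesOn c (RP , RL)) outdegreeOn ⟩
    outdegreeOn + pebblesOn c (RP , RL) ∎)
    where open ≤-Reasoning

-- Gathering pebbles on p₀ and ℓ₀

incidencesOf : ∀ {np nl lam} → Orientation np nl lam → Incidences np nl
incidencesOf a p ℓ = anyFin (λ i → is-just (a p ℓ i))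

module Strategy {np nl : ℕ} (I : Incidences np nl) (lam k₁ k₂ l : ℕ)
                (p₀ : Fin np) (ℓ₀ : Fin nl) (I₀ : I p₀ ℓ₀ ≡ true) where

  record Invariant (c : Config np nl lam) : Set where
    field
      balanced : PebbleBalance k₁ k₂ c
      sparse   : Sparse lam k₁ k₂ l (ID c)
      incident : ID c p₀ ℓ₀ ≡ true
  open Invariant

  invariant-move : ∀ {c c′} → Move I lam k₁ k₂ l c c′ → ID c′ ⊆I ID c → Invariant c → Invariant c′
  invariant-move m ID′⊆ID inv = record
    { balanced = move-balanced m (balanced inv)
    ; sparse   = sparse-⊆ {lam = lam} {k₁} {k₂} {l} ID′⊆ID (sparse inv)
    ; incident = anyFin-mono (λ i → move-keeps-accepted m p₀ ℓ₀ i) (incident inv)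
    }

  ID-reverse : ∀ (a : Orientation np nl lam) es → incidencesOf (reverseEdges a es) ⊆I incidencesOf a
  ID-reverse a es p ℓ = anyFin-mono λ i h → trans (sym (reverseEdges-is-just a es p ℓ i)) h

  ID-accept : ∀ (a : Orientation np nl lam) i d → incidencesOf a p₀ ℓ₀ ≡ true →
              incidencesOf (setAcc a (p₀ , ℓ₀ , i) d) ⊆I incidencesOf a
  ID-accept a i d ID₀ p ℓ h with p Fin.≟ p₀ | ℓ Fin.≟ ℓ₀
  ... | yes refl | yes refl = ID₀
  ... | no  _    | _        = h
  ... | yes _    | no  _    = h

  baseSum : (Vertex np nl → ℕ) → ℕ
  baseSum f = f (inj₁ p₀) + f (inj₂ ℓ₀)

  Source : Vertex np nl → Set
  Source v = v ≡ inj₁ p₀ ⊎ v ≡ inj₂ ℓ₀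

  sources : VertexSet np nl
  sources = (λ p → _=V_ {np} {nl} (inj₁ p) (inj₁ p₀)) , (λ ℓ → _=V_ {np} {nl} (inj₂ ℓ) (inj₂ ℓ₀))

  sources-sound : ∀ v → member sources v ≡ true → Source v
  sources-sound (inj₁ p) h = inj₁ (=V-sound (inj₁ p) (inj₁ p₀) h)
  sources-sound (inj₂ ℓ) h = inj₂ (=V-sound (inj₂ ℓ) (inj₂ ℓ₀) h)

  δ-source : ∀ {v} → Source v → δ (inj₁ p₀) v + δ (inj₂ ℓ₀) v ≡ 1
  δ-source (inj₁ refl) rewrite =V-refl {np} {nl} (inj₁ p₀) = refl
  δ-source (inj₂ refl) rewrite =V-refl {np} {nl} (inj₂ ℓ₀) = refl

  δ-nonsource : ∀ {x w} → Source x → ¬ Source w → δ x w ≡ 0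
  δ-nonsource {x} {w} sx nw = cong (λ b → guard b 1) (=V-≢ x w λ { refl → nw sx })

  transfer-gain : ∀ (f : Vertex np nl → ℕ) v w → 0 < f w → Source v → ¬ Source w →
                  baseSum (adjust (adjust f v suc) w (λ n → n ∸ 1)) ≡ suc (baseSum f)
  transfer-gain f v w pos sv nw = begin
    f′ P + f′ L                    ≡⟨ cong₂ _+_ (gain (inj₁ refl)) (gain (inj₂ refl)) ⟩
    (δ P v + f P) + (δ L v + f L)  ≡⟨ regroup (δ P v) (f P) (δ L v) (f L) ⟩
    (δ P v + δ L v) + (f P + f L)  ≡⟨ cong (_+ baseSum f) (δ-source sv) ⟩
    suc (baseSum f)                ∎
    where
    open ≡-Reasoning
    P = inj₁ p₀
    L = inj₂ ℓ₀
    f′ = adjust (adjust f v suc) w (λ n → n ∸ 1)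
    gain : ∀ {x} → Source x → f′ x ≡ δ x v + f x
    gain {x} sx = begin
      f′ x          ≡⟨ +-identityʳ (f′ x) ⟨
      f′ x + 0      ≡⟨ cong (f′ x +_) (δ-nonsource sx nw) ⟨
      f′ x + δ x w  ≡⟨ cross (adjust-transfer f v w pos x) ⟩
      δ x v + f x   ∎
    regroup : ∀ a b c d → (a + b) + (c + d) ≡ (a + c) + (b + d)
    regroup = solve-∀

  guard-pos : ∀ b n → 0 < guard b n → b ≡ true × 0 < n
  guard-pos true n pos = refl , pos

  Gathered : Config np nl lam → Fin lam → (ℕ → Set) → Set
  Gathered c i₀ enough = Σ (Config np nl lam) λ c′ →
    Moves I lam k₁ k₂ l c c′ × Invariant c′ × acc c′ p₀ ℓ₀ i₀ ≡ nothing × enough (baseSum (peb c′))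

  module GatherStep (c : Config np nl lam) (inv : Invariant c) {i₀} (free : acc c p₀ ℓ₀ i₀ ≡ nothing)
                    (few : baseSum (peb c) ≤ l) where
    open Reachability c
    R  = closure sources
    RP = proj₁ R
    RL = proj₂ R

    many : l < pebblesOn c R
    many = ClosedSetPebbles.pebbles-on-closed c (balanced inv) (sparse inv) RP RL
      (closure-closed sources) (proj₁ (closure-⊇ sources) p₀ (=V-refl {np} {nl} (inj₁ p₀)))
      (proj₂ (closure-⊇ sources) ℓ₀ (=V-refl {np} {nl} (inj₂ ℓ₀))) (incident inv) free

    pull-from : ∀ w → member R w ≡ true → ¬ Source w → 0 < peb c w → Gathered c i₀ (baseSum (peb c) <_)
    pull-from w Rw nw pos with s , Ss , ws ← closure-reachable sources w Rw =
      _ , move ◅ ε , invariant-move move (ID-reverse (acc c) (walkEdges (walk π))) inv ,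
      reverseEdges-nothing (acc c) (walkEdges (walk π)) p₀ ℓ₀ i₀ free ,
      ≤-reflexive (sym (transfer-gain (peb c) s w pos (sources-sound s Ss) nw))
      where
      π = walk-path ws
      move = move-pebble {I = I} {lam} {k₁} {k₂} {l} s w π pos

    step : Gathered c i₀ (baseSum (peb c) <_)
    step with positive-elsewhere-or-sumFin≤ (λ p → guard (RP p) (peb c (inj₁ p))) p₀
            | positive-elsewhere-or-sumFin≤ (λ ℓ → guard (RL ℓ) (peb c (inj₂ ℓ))) ℓ₀
    ... | inj₁ (p , p≢p₀ , pos) | _ =
      let RPp , pos′ = guard-pos (RP p) _ pos in
      pull-from (inj₁ p) RPp (λ { (inj₁ eq) → p≢p₀ (Sum.inj₁-injective eq) ; (inj₂ ()) }) pos′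
    ... | inj₂ _ | inj₁ (ℓ , ℓ≢ℓ₀ , pos) =
      let RLℓ , pos′ = guard-pos (RL ℓ) _ pos in
      pull-from (inj₂ ℓ) RLℓ (λ { (inj₁ ()) ; (inj₂ eq) → ℓ≢ℓ₀ (Sum.inj₂-injective eq) }) pos′
    ... | inj₂ onlyP | inj₂ onlyL = ⊥-elim (<⇒≱ many (begin
      pebblesOn c R
        ≤⟨ +-mono-≤ onlyP onlyL ⟩
      guard (RP p₀) (peb c (inj₁ p₀)) + guard (RL ℓ₀) (peb c (inj₂ ℓ₀))
        ≤⟨ +-mono-≤ (guard-≤ (RP p₀) _) (guard-≤ (RL ℓ₀) _) ⟩
      baseSum (peb c)
        ≤⟨ few ⟩
      l ∎))
      where open ≤-Reasoning

  gather : ∀ n c → Invariant c → ∀ {i₀} → acc c p₀ ℓ₀ i₀ ≡ nothing → l < n + baseSum (peb c) →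
           Gathered c i₀ (l <_)
  gather zero    c inv free enough = c , ε , inv , free , enough
  gather (suc n) c inv free enough with l <? baseSum (peb c)
  ... | yes ok  = c , ε , inv , free , ok
  ... | no  few
    with c₁ , m₁ , inv₁ , free₁ , gain ← GatherStep.step c inv free (≮⇒≥ few)
    with c₂ , m₂ , inv₂ , free₂ , ok ← gather n c₁ inv₁ free₁
      (<-≤-trans enough (≤-trans (≤-reflexive (sym (+-suc n (baseSum (peb c))))) (+-monoʳ-≤ n gain)))
    = c₂ , m₁ ◅◅ m₂ , inv₂ , free₂ , ok

  Accepted : Config np nl lam → Fin lam → Set
  Accepted c i = is-just (acc c p₀ ℓ₀ i) ≡ true

  Accepts : Config np nl lam → (Fin lam → Set) → Set
  Accepts c wanted = Σ (Config np nl lam) λ c′ →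
    Moves I lam k₁ k₂ l c c′ × Invariant c′ × (∀ i → wanted i → Accepted c′ i)

  accept-move : ∀ c i → acc c p₀ ℓ₀ i ≡ nothing → l < baseSum (peb c) → ∃ λ d →
    Move I lam k₁ k₂ l c (config (setAcc (acc c) (p₀ , ℓ₀ , i) (just d))
                                 (adjust (peb c) (tail d (p₀ , ℓ₀ , i)) (λ n → n ∸ 1)))
  accept-move c i free enough with 0 <? peb c (inj₁ p₀)
  ... | yes pos  = P→L , accept-P p₀ ℓ₀ i I₀ free enough pos
  ... | no  npos = L→P , accept-L p₀ ℓ₀ i I₀ free enough
    (≤-trans (s≤s z≤n) (subst (λ x → l < x + peb c (inj₂ ℓ₀)) (n≤0⇒n≡0 (≮⇒≥ npos)) enough))

  accept-one : ∀ c → Invariant c → ∀ i → acc c p₀ ℓ₀ i ≡ nothing → Accepts c (_≡ i)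
  accept-one c inv i free
    with c₁ , m₁ , inv₁ , free₁ , enough ← gather (suc l) c inv free (m≤m+n (suc l) _)
    with d , move ← accept-move c₁ i free₁ enough
    = _ , m₁ ◅◅ (move ◅ ε) ,
      invariant-move move (ID-accept (acc c₁) i (just d) (incident inv₁)) inv₁ ,
      λ { _ refl → cong is-just (setAcc-here (acc c₁) (p₀ , ℓ₀ , i) (just d)) }

  accept-if-needed : ∀ c → Invariant c → ∀ i → Accepts c (_≡ i)
  accept-if-needed c inv i with acc c p₀ ℓ₀ i in eq
  ... | just _  = c , ε , inv , λ { _ refl → cong is-just eq }
  ... | nothing = accept-one c inv i eq

  accept-all : ∀ (is : List (Fin lam)) c → Invariant c → Accepts c (_∈ is)
  accept-all []       c inv = c , ε , inv , λ _ ()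
  accept-all (i ∷ is) c inv
    with c₁ , m₁ , inv₁ , accepted₁ ← accept-if-needed c inv i
    with c₂ , m₂ , inv₂ , accepted₂ ← accept-all is c₁ inv₁
    = c₂ , m₁ ◅◅ m₂ , inv₂ , λ
      { _ (here refl) → Moves-preserve (λ m → move-keeps-accepted m p₀ ℓ₀ i) m₂ (accepted₁ i refl)
      ; j (there j∈is) → accepted₂ j j∈is }

lemma3 : (np nl : ℕ) (I : Incidences np nl) (lam k₁ k₂ l : ℕ) →
    l + lam ≤ k₁ + k₂ →
    (c : Config np nl lam) → Moves I lam k₁ k₂ l (initial k₁ k₂) c →
    (p₀ : Fin np) (ℓ₀ : Fin nl) → ID c p₀ ℓ₀ ≡ true →
    (∀ p ℓ → ID c p ℓ ≡ true → ¬ ((p , ℓ) ≡ (p₀ , ℓ₀)) →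
      ∀ i → is-just (acc c p ℓ i) ≡ true) →
    (∃ λ i → acc c p₀ ℓ₀ i ≡ nothing) →
    Sparse lam k₁ k₂ l (ID c) →
    Σ (Config np nl lam) λ c' → Moves I lam k₁ k₂ l c c' ×
      (∀ i → is-just (acc c' p₀ ℓ₀ i) ≡ true)
lemma3 np nl I lam k₁ k₂ l _ c play p₀ ℓ₀ ID₀ _ _ sparse =
  let c′ , moves , _ , accepted = Strategy.accept-all I lam k₁ k₂ l p₀ ℓ₀ I₀ (allFin lam) c invariant
  in  c′ , moves , λ i → accepted i (∈-allFin i)
  where
  I₀ : I p₀ ℓ₀ ≡ true
  I₀ = let i , accepted = anyFin-sound _ ID₀ in
       Moves-preserve move-accepted-within play (λ _ _ _ ()) p₀ ℓ₀ i accepted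
  invariant : Strategy.Invariant I lam k₁ k₂ l p₀ ℓ₀ I₀ c
  invariant = record
    { balanced = Moves-preserve move-balanced play (initial-balanced k₁ k₂)
    ; sparse   = sparse
    ; incident = ID₀
    }
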